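{- Let $\mathcal{H}$ be a 3-uniform hypergraph containing no copy of $\mathcal{L}$, let $\mathcal{H}'$ be its 22-core, and let $Y$ be the set of vertices $y \in V(\mathcal{H}')$ with $\nu(Tr_{\mathcal{H}'}(y)) \ge 4$. For any $y \in Y$, every connected component of the graph $Tr_{\mathcal{H}'}(y)$ has either at most 2 vertices or at least 23 vertices.
   Context: The loose path $\mathcal{L}$ is $\{abc, cde, efg\}$ on seven distinct vertices. The 22-core is obtained by iteratively deleting vertices of degree less than 22 (with their triples) until all remaining vertices have degree at least 22. $Tr_{\mathcal{H}'}(v) = \{ e \setminus \{v\} : e \in \mathcal{H}', v \in e\}$ is the trace graph of $v$ (its vertices are those covered by its edges); $\nu$ is the matching number. -}

module Defs where

open import Data.Nat using (ℕ; zero; suc; _+_; _≤_; _<_)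
open import Data.Nat.Base using (_<ᵇ_)
open import Data.Bool using (Bool; true; false; _∧_; not; if_then_else_)
open import Data.Fin using (Fin; toℕ)
open import Data.Fin.Properties using (_≟_)
open import Data.List using (List; []; _∷_; length; map; allFin)
open import Data.Nat.ListAction using (sum)
open import Data.List.Relation.Unary.All using (All)
open import Data.List.Relation.Unary.Unique.Propositional using (Unique)
open import Data.List.Membership.Propositional using (_∈_)
open import Data.Product using (Σ; ∃; ∃-syntax; _×_; _,_)
open import Relation.Binary.PropositionalEquality using (_≡_)
open import Relation.Binary.Construct.Closure.ReflexiveTransitive using (Star)
open import Relation.Nullary.Decidable using (⌊_⌋)

-- A 3-uniform hypergraph on the vertex set Fin n.  E a b c = true means
-- that the triple {a,b,c} is an edge; E is symmetric and only holds on
-- three distinct vertices.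
record Hypergraph3 (n : ℕ) : Set where
  field
    E      : Fin n → Fin n → Fin n → Bool
    sym₁₂  : ∀ a b c → E a b c ≡ E b a c
    sym₂₃  : ∀ a b c → E a b c ≡ E a c b
    distinct : ∀ a b c → E a b c ≡ true → Unique (a ∷ b ∷ c ∷ [])
open Hypergraph3 public

VSet : ℕ → Set
VSet n = Fin n → Bool

full : ∀ {n} → VSet n
full _ = true

countB : ∀ {n} → (Fin n → Bool) → ℕ
countB {n} p = sum (map (λ i → if p i then 1 else 0) (allFin n))

-- degree of v in the sub-hypergraph H[S] (edges with all vertices in S):
-- number of unordered pairs {u,w} (u < w) with {v,u,w} an edge inside S
degIn : ∀ {n} → Hypergraph3 n → VSet n → Fin n → ℕ
degIn {n} H S v =
  sum (map (λ u → countB (λ w → (toℕ u <ᵇ toℕ w) ∧ S v ∧ S u ∧ S w ∧ E H v u w))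
           (allFin n))

DelStep : ∀ {n} → ℕ → Hypergraph3 n → VSet n → VSet n → Set
DelStep k H S T =
  ∃[ v ] (S v ≡ true × degIn H S v < k ×
          (∀ x → T x ≡ (S x ∧ not ⌊ x ≟ v ⌋)))

-- S is (the vertex set of) the k-core of H: obtained from V(H) by
-- iteratively deleting vertices of degree < k, until all remaining
-- vertices have degree ≥ k.  The k-core is H[S].
IsCore : ∀ {n} → ℕ → Hypergraph3 n → VSet n → Set
IsCore k H S =
  Star (DelStep k H) full S × (∀ v → S v ≡ true → k ≤ degIn H S v)

-- H contains no copy of the loose path L = {abc, cde, efg}
LFree : ∀ {n} → Hypergraph3 n → Set
LFree H = ∀ a b c d e f g → Unique (a ∷ b ∷ c ∷ d ∷ e ∷ f ∷ g ∷ []) →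
  E H a b c ≡ true → E H c d e ≡ true → E H e f g ≡ true → Data.Empty.⊥
  where import Data.Empty

TrEdge : ∀ {n} → Hypergraph3 n → VSet n → Fin n → Fin n → Fin n → Set
TrEdge H S y u w = (S y ∧ S u ∧ S w ∧ E H y u w) ≡ true

-- vertices of the trace graph: those covered by its edges
TrVertex : ∀ {n} → Hypergraph3 n → VSet n → Fin n → Fin n → Set
TrVertex H S y u = ∃[ w ] TrEdge H S y u w

flatten : ∀ {n} → List (Fin n × Fin n) → List (Fin n)
flatten [] = []
flatten ((u , w) ∷ ps) = u ∷ w ∷ flatten ps

IsTrMatching : ∀ {n} → Hypergraph3 n → VSet n → Fin n → List (Fin n × Fin n) → Set
IsTrMatching H S y M =
  All (λ { (u , w) → TrEdge H S y u w }) M × Unique (flatten M)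

MatchingNumberAtLeast : ∀ {n} → Hypergraph3 n → VSet n → Fin n → ℕ → Set
MatchingNumberAtLeast H S y k =
  ∃[ M ] (IsTrMatching H S y M × length M ≡ k)

TrConnected : ∀ {n} → Hypergraph3 n → VSet n → Fin n → Fin n → Fin n → Set
TrConnected H S y = Star (TrEdge H S y)

ComponentAtMost : ∀ {n} → Hypergraph3 n → VSet n → Fin n → Fin n → ℕ → Set
ComponentAtMost H S y x k =
  ∃[ L ] (length L ≤ k × (∀ z → TrConnected H S y x z → z ∈ L))

ComponentAtLeast : ∀ {n} → Hypergraph3 n → VSet n → Fin n → Fin n → ℕ → Set
ComponentAtLeast H S y x k =
  ∃[ L ] (length L ≡ k × Unique L × All (TrConnected H S y x) L)

-- Structural lemma (link-contains): if {y,v,u} ∈ H[S], every edge {v,p,q}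
-- of H avoiding y contains u; otherwise a matching edge of Tr(y) disjoint
-- from the few vertices involved closes a loose path abc, cde, efg.
-- Hence if v has two trace neighbours u₁ ≠ u₂, either it has a third one,
-- so every edge at v contains y and deg(v) ≤ deg_{Tr(y)}(v), or all edges
-- at v lie in {v,y,u₁,u₂} and deg(v) ≤ 9.  As deg(v) ≥ 22 in the core, v
-- has ≥ 22 trace neighbours, and a component is either a single edge or
-- has ≥ 23 vertices.

module Submission where

open import Defs
open import Data.Nat using (ℕ; zero; suc; _+_; _*_; _≤_; _<_; z≤n; s≤s; s≤s⁻¹; _<ᵇ_)
open import Data.Nat.Properties
  using (≤-refl; ≤-trans; ≤-reflexive; <-≤-trans; +-mono-≤; +-monoʳ-≤; +-comm; +-assoc;
         m≤n+m; m≤m+n; *-identityˡ; *-distribʳ-+; *-mono-≤; <-asym; <ᵇ⇒<; <⇒≱;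
         m≤n⇒m⊓n≡m; +-commutativeSemigroup; module ≤-Reasoning)
open import Algebra.Properties.CommutativeSemigroup +-commutativeSemigroup using (interchange)
open import Data.Fin using (Fin; zero; suc; toℕ)
open import Data.Fin.Properties using (_≟_; suc-injective; any?)
open import Data.Bool using (Bool; true; false; _∧_; _∨_; T; if_then_else_) renaming (_≟_ to _≟ᵇ_)
open import Data.Bool.Properties using (∨-zeroʳ)
open import Data.Unit using (tt)
open import Data.List using (List; []; _∷_; length; map; allFin; tabulate; filter; take)
open import Data.List.Properties using (map-tabulate; length-take; filter-notAll)
open import Data.Nat.ListAction using (sum)
open import Data.List.Relation.Unary.All as All using (All; []; _∷_)
import Data.List.Relation.Unary.All.Properties as All
open import Data.List.Relation.Unary.Any as Any using (here; there)
open import Data.List.Relation.Unary.AllPairs using ([]; _∷_)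
open import Data.List.Relation.Unary.Unique.Propositional using (Unique)
import Data.List.Relation.Unary.Unique.Propositional.Properties as Unique
open import Data.List.Membership.Propositional using (_∈_; _∉_)
open import Data.List.Membership.Propositional.Properties using (∈-filter⁺)
open import Data.Product using (∃-syntax; _×_; _,_; proj₁; proj₂)
open import Data.Sum using (_⊎_; inj₁; inj₂)
open import Data.Empty using (⊥; ⊥-elim)
open import Function using (_∘_; id)
open import Relation.Nullary using (yes; no)
open import Relation.Nullary.Decidable using (⌊_⌋; ¬?; _×-dec_; decidable-stable)
open import Relation.Binary.PropositionalEquality
  using (_≡_; _≢_; refl; sym; trans; cong; cong₂; subst; ≢-sym)
open import Relation.Binary.Construct.Closure.ReflexiveTransitive using (ε; _◅_; _◅◅_)

∧-true⁻ : ∀ a {b} → a ∧ b ≡ true → a ≡ true × b ≡ true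
∧-true⁻ true b≡true = refl , b≡true

∧-mapʳ : ∀ a {b c} → (b ≡ true → c ≡ true) → a ∧ b ≡ true → a ∧ c ≡ true
∧-mapʳ true f = f

∧₄-true⁻ : ∀ a b c d → a ∧ b ∧ c ∧ d ≡ true →
  a ≡ true × b ≡ true × c ≡ true × d ≡ true
∧₄-true⁻ true true true true refl = refl , refl , refl , refl
∧₄-true⁻ false _ _ _ ()
∧₄-true⁻ true false _ _ ()
∧₄-true⁻ true true false _ ()
∧₄-true⁻ true true true false ()

∧₄-true⁺ : ∀ {a b c d} → a ≡ true → b ≡ true → c ≡ true → d ≡ true → a ∧ b ∧ c ∧ d ≡ true
∧₄-true⁺ refl refl refl refl = refl

<ᵇ-sound : ∀ m n → (m <ᵇ n) ≡ true → m < n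
<ᵇ-sound m n m<ᵇn = <ᵇ⇒< m n (subst T (sym m<ᵇn) tt)

≟-sound : ∀ {n} {i j : Fin n} → ⌊ i ≟ j ⌋ ≡ true → i ≡ j
≟-sound {i = i} {j} i≟j with i ≟ j
... | yes i≡j = i≡j
≟-sound {i = i} {j} () | no _

ind : Bool → ℕ
ind b = if b then 1 else 0

ind≤1 : ∀ b → ind b ≤ 1
ind≤1 true = ≤-refl
ind≤1 false = z≤n

ind-mono : ∀ {a b} → (a ≡ true → b ≡ true) → ind a ≤ ind b
ind-mono {false} _ = z≤n
ind-mono {true} a⇒b rewrite a⇒b refl = ≤-refl

sumF : ∀ {n} → (Fin n → ℕ) → ℕ
sumF {zero} h = 0
sumF {suc n} h = h zero + sumF (h ∘ suc)

sum-tabulate : ∀ {n} (h : Fin n → ℕ) → sum (tabulate h) ≡ sumF h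
sum-tabulate {zero} h = refl
sum-tabulate {suc n} h = cong (h zero +_) (sum-tabulate (h ∘ suc))

sum-allFin : ∀ {n} (h : Fin n → ℕ) → sum (map h (allFin n)) ≡ sumF h
sum-allFin h = trans (cong sum (map-tabulate id h)) (sum-tabulate h)

countB-sumF : ∀ {n} (p : Fin n → Bool) → countB p ≡ sumF (ind ∘ p)
countB-sumF p = sum-allFin (ind ∘ p)

sumF-mono : ∀ {n} {f g : Fin n → ℕ} → (∀ i → f i ≤ g i) → sumF f ≤ sumF g
sumF-mono {zero} _ = z≤n
sumF-mono {suc n} f≤g = +-mono-≤ (f≤g zero) (sumF-mono (f≤g ∘ suc))

sumF-+ : ∀ {n} (f g : Fin n → ℕ) → sumF (λ i → f i + g i) ≡ sumF f + sumF g
sumF-+ {zero} f g = refl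
sumF-+ {suc n} f g =
  trans (cong (f zero + g zero +_) (sumF-+ (f ∘ suc) (g ∘ suc)))
        (interchange (f zero) (g zero) (sumF (f ∘ suc)) (sumF (g ∘ suc)))

sumF-*ʳ : ∀ {n} (f : Fin n → ℕ) k → sumF (λ i → f i * k) ≡ sumF f * k
sumF-*ʳ {zero} f k = refl
sumF-*ʳ {suc n} f k =
  trans (cong (f zero * k +_) (sumF-*ʳ (f ∘ suc) k)) (sym (*-distribʳ-+ k (f zero) _))

sumF-zero : ∀ {n} → sumF {n} (λ _ → 0) ≡ 0
sumF-zero {zero} = refl
sumF-zero {suc n} = sumF-zero {n}

sumF-except : ∀ {n} (f g : Fin n → ℕ) (a : Fin n) →
  (∀ i → i ≢ a → f i ≤ g i) → sumF f ≤ sumF g + f a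
sumF-except f g zero f≤g = begin
  f zero + sumF (f ∘ suc) ≤⟨ +-monoʳ-≤ (f zero) (sumF-mono (λ i → f≤g (suc i) (λ ()))) ⟩
  f zero + sumF (g ∘ suc) ≤⟨ +-monoʳ-≤ (f zero) (m≤n+m _ (g zero)) ⟩
  f zero + sumF g         ≡⟨ +-comm (f zero) (sumF g) ⟩
  sumF g + f zero         ∎
  where open ≤-Reasoning
sumF-except f g (suc a) f≤g = begin
  f zero + sumF (f ∘ suc)                  ≤⟨ +-mono-≤ (f≤g zero (λ ())) rest ⟩
  g zero + (sumF (g ∘ suc) + f (suc a))   ≡⟨ sym (+-assoc (g zero) _ _) ⟩
  sumF g + f (suc a)                       ∎
  where
  open ≤-Reasoning
  rest : sumF (f ∘ suc) ≤ sumF (g ∘ suc) + f (suc a)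
  rest = sumF-except (f ∘ suc) (g ∘ suc) a (λ i i≢a → f≤g (suc i) (i≢a ∘ suc-injective))

countB-mono : ∀ {n} {p q : Fin n → Bool} → (∀ i → p i ≡ true → q i ≡ true) → countB p ≤ countB q
countB-mono {p = p} {q} p⇒q = begin
  countB p       ≡⟨ countB-sumF p ⟩
  sumF (ind ∘ p) ≤⟨ sumF-mono (λ i → ind-mono (p⇒q i)) ⟩
  sumF (ind ∘ q) ≡⟨ countB-sumF q ⟨
  countB q       ∎
  where open ≤-Reasoning

countB-false : ∀ {n} → countB {n} (λ _ → false) ≡ 0
countB-false {n} = trans (countB-sumF {n} (λ _ → false)) (sumF-zero {n})

countB-single : ∀ {n} {p : Fin n → Bool} {a : Fin n} →
  (∀ i → p i ≡ true → i ≡ a) → countB p ≤ ind (p a)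
countB-single {n} {p} {a} onlyA = begin
  countB p                   ≡⟨ countB-sumF p ⟩
  sumF (ind ∘ p)             ≤⟨ sumF-except (ind ∘ p) (λ _ → 0) a vanish ⟩
  sumF {n} (λ _ → 0) + ind (p a) ≡⟨ cong (_+ ind (p a)) (sumF-zero {n}) ⟩
  ind (p a)                  ∎
  where
  open ≤-Reasoning
  vanish : ∀ i → i ≢ a → ind (p i) ≤ 0
  vanish i i≢a with p i in pi
  ... | true = ⊥-elim (i≢a (onlyA i pi))
  ... | false = z≤n

countB-+ : ∀ {n} (p q : Fin n → Bool) → countB p + countB q ≡ sumF (λ i → ind (p i) + ind (q i))
countB-+ p q = trans (cong₂ _+_ (countB-sumF p) (countB-sumF q)) (sym (sumF-+ (ind ∘ p) (ind ∘ q)))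

countB-∨ : ∀ {n} (p q : Fin n → Bool) → countB (λ i → p i ∨ q i) ≤ countB p + countB q
countB-∨ p q = begin
  countB (λ i → p i ∨ q i)             ≡⟨ countB-sumF (λ i → p i ∨ q i) ⟩
  sumF (λ i → ind (p i ∨ q i))         ≤⟨ sumF-mono pointwise ⟩
  sumF (λ i → ind (p i) + ind (q i))   ≡⟨ countB-+ p q ⟨
  countB p + countB q                  ∎
  where
  open ≤-Reasoning
  pointwise : ∀ i → ind (p i ∨ q i) ≤ ind (p i) + ind (q i)
  pointwise i with p i | q i
  ... | true | _ = s≤s z≤n
  ... | false | true = ≤-refl
  ... | false | false = z≤n

countB-disjoint : ∀ {n} (p q r : Fin n → Bool) → (∀ i → p i ≡ true → q i ≡ true → ⊥) →
  (∀ i → p i ≡ true → r i ≡ true) → (∀ i → q i ≡ true → r i ≡ true) →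
  countB p + countB q ≤ countB r
countB-disjoint p q r disjoint p⇒r q⇒r = begin
  countB p + countB q                  ≡⟨ countB-+ p q ⟩
  sumF (λ i → ind (p i) + ind (q i))   ≤⟨ sumF-mono pointwise ⟩
  sumF (ind ∘ r)                       ≡⟨ countB-sumF r ⟨
  countB r                             ∎
  where
  open ≤-Reasoning
  pointwise : ∀ i → ind (p i) + ind (q i) ≤ ind (r i)
  pointwise i with p i in pi | q i in qi
  ... | false | false = z≤n
  ... | true | false rewrite p⇒r i pi = ≤-refl
  ... | false | true rewrite q⇒r i qi = ≤-refl
  ... | true | true = ⊥-elim (disjoint i pi qi)

memberB : ∀ {n} → List (Fin n) → Fin n → Bool
memberB [] w = false
memberB (x ∷ xs) w = ⌊ w ≟ x ⌋ ∨ memberB xs w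

memberB-∈ : ∀ {n} {xs : List (Fin n)} {w} → w ∈ xs → memberB xs w ≡ true
memberB-∈ {xs = x ∷ xs} {w} (here w≡x) with w ≟ x
... | yes _ = refl
... | no w≢x = ⊥-elim (w≢x w≡x)
memberB-∈ {xs = x ∷ xs} {w} (there w∈xs) rewrite memberB-∈ w∈xs = ∨-zeroʳ _

countB-memberB : ∀ {n} (xs : List (Fin n)) → countB (memberB xs) ≤ length xs
countB-memberB {n} [] = ≤-reflexive (countB-false {n})
countB-memberB {n} (x ∷ xs) =
  ≤-trans (countB-∨ (λ w → ⌊ w ≟ x ⌋) (memberB xs))
          (+-mono-≤ (≤-trans (countB-single {p = λ w → ⌊ w ≟ x ⌋} {a = x} (λ _ → ≟-sound)) (ind≤1 _)) (countB-memberB xs))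

length-filter-true : ∀ {A : Set} (p : A → Bool) (xs : List A) →
  length (filter (λ i → p i ≟ᵇ true) xs) ≡ sum (map (ind ∘ p) xs)
length-filter-true p [] = refl
length-filter-true p (x ∷ xs) with p x
... | true = cong suc (length-filter-true p xs)
... | false = length-filter-true p xs

pairCount : ∀ {n} → (Fin n → Fin n → Bool) → ℕ
pairCount R = sumF (λ u → countB (λ w → (toℕ u <ᵇ toℕ w) ∧ R u w))

pairCount-box : ∀ {n} {R : Fin n → Fin n → Bool} (Z : Fin n → Bool) →
  (∀ u w → R u w ≡ true → Z u ≡ true × Z w ≡ true) → pairCount R ≤ countB Z * countB Z
pairCount-box {n} {R} Z inZ = begin
  pairCount R                        ≤⟨ sumF-mono row ⟩
  sumF (λ u → ind (Z u) * countB Z)  ≡⟨ sumF-*ʳ (ind ∘ Z) (countB Z) ⟩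
  sumF (ind ∘ Z) * countB Z          ≡⟨ cong (_* countB Z) (countB-sumF Z) ⟨
  countB Z * countB Z                ∎
  where
  open ≤-Reasoning
  row : ∀ u → countB (λ w → (toℕ u <ᵇ toℕ w) ∧ R u w) ≤ ind (Z u) * countB Z
  row u with Z u in Zu
  ... | true = ≤-trans (countB-mono (λ w e → proj₂ (inZ u w (proj₂ (∧-true⁻ _ e)))))
                       (≤-reflexive (sym (*-identityˡ (countB Z))))
  ... | false = ≤-trans (countB-mono {q = λ _ → false}
                          (λ w e → trans (sym Zu) (proj₁ (inZ u w (proj₂ (∧-true⁻ _ e))))))
                        (≤-reflexive (countB-false {n}))

-- If every pair contains a and the partner of a always satisfies N, the
-- pairs number at most |N|: the pair {u,a} is counted once, in the row of
-- the smaller of u and a.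
pairCount-star : ∀ {n} {R : Fin n → Fin n → Bool} (a : Fin n) (N : Fin n → Bool) →
  (∀ u w → R u w ≡ true → u ≢ a → w ≢ a → ⊥) →
  (∀ w → R a w ≡ true → N w ≡ true) → (∀ u → R u a ≡ true → N u ≡ true) →
  pairCount R ≤ countB N
pairCount-star {n} {R} a N throughA right left = begin
  sumF row                          ≤⟨ sumF-except row (ind ∘ below) a rowBound ⟩
  sumF (ind ∘ below) + row a        ≤⟨ +-mono-≤ (≤-reflexive (sym (countB-sumF below)))
                                               (countB-mono (λ w → ∧-mapʳ _ (right w))) ⟩
  countB below + countB above       ≤⟨ countB-disjoint below above N disjoint
                                         (λ i → proj₂ ∘ ∧-true⁻ _) (λ i → proj₂ ∘ ∧-true⁻ _) ⟩
  countB N                          ∎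
  where
  open ≤-Reasoning
  row : Fin n → ℕ
  row u = countB (λ w → (toℕ u <ᵇ toℕ w) ∧ R u w)
  below above : Fin n → Bool
  below u = (toℕ u <ᵇ toℕ a) ∧ N u
  above w = (toℕ a <ᵇ toℕ w) ∧ N w
  rowBound : ∀ u → u ≢ a → row u ≤ ind (below u)
  rowBound u u≢a = ≤-trans (countB-single {p = λ w → (toℕ u <ᵇ toℕ w) ∧ R u w} onlyA)
                           (ind-mono (∧-mapʳ (toℕ u <ᵇ toℕ a) (left u)))
    where
    onlyA : ∀ w → (toℕ u <ᵇ toℕ w) ∧ R u w ≡ true → w ≡ a
    onlyA w e = decidable-stable (w ≟ a) (throughA u w (proj₂ (∧-true⁻ _ e)) u≢a)
  disjoint : ∀ i → below i ≡ true → above i ≡ true → ⊥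
  disjoint i i<a a<i =
    <-asym (<ᵇ-sound (toℕ i) (toℕ a) (proj₁ (∧-true⁻ _ i<a)))
           (<ᵇ-sound (toℕ a) (toℕ i) (proj₁ (∧-true⁻ _ a<i)))

module Matchings {n : ℕ} where
  open import Data.List.Membership.DecPropositional (_≟_ {n}) using (_∈?_)

  _∈ₚ_ : Fin n → Fin n × Fin n → Set
  z ∈ₚ (a , b) = z ≡ a ⊎ z ≡ b

  endpoint-covered : ∀ {M : List (Fin n × Fin n)} {P z} → P ∈ M → z ∈ₚ P → z ∈ flatten M
  endpoint-covered {_ ∷ _} (here refl) (inj₁ refl) = here refl
  endpoint-covered {_ ∷ _} (here refl) (inj₂ refl) = there (here refl)
  endpoint-covered {_ ∷ _} (there P∈M) z∈P = there (there (endpoint-covered P∈M z∈P))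

  head-apart : ∀ {a b z xs} → All (a ≢_) (b ∷ xs) → All (b ≢_) xs → z ∈ₚ (a , b) → z ∈ xs → ⊥
  head-apart a∉ _ (inj₁ refl) z∈xs = All.lookup a∉ (there z∈xs) refl
  head-apart _ b∉ (inj₂ refl) z∈xs = All.lookup b∉ z∈xs refl

  matching-shared : ∀ {M : List (Fin n × Fin n)} {P Q z} → Unique (flatten M) →
    P ∈ M → Q ∈ M → z ∈ₚ P → z ∈ₚ Q → P ≡ Q
  matching-shared _ (here refl) (here refl) _ _ = refl
  matching-shared (a∉ ∷ b∉ ∷ _) (here refl) (there Q∈M) z∈P z∈Q =
    ⊥-elim (head-apart a∉ b∉ z∈P (endpoint-covered Q∈M z∈Q))
  matching-shared (a∉ ∷ b∉ ∷ _) (there P∈M) (here refl) z∈P z∈Q =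
    ⊥-elim (head-apart a∉ b∉ z∈Q (endpoint-covered P∈M z∈P))
  matching-shared (_ ∷ _ ∷ u) (there P∈M) (there Q∈M) z∈P z∈Q = matching-shared u P∈M Q∈M z∈P z∈Q

  Avoids : List (Fin n × Fin n) → List (Fin n) → Set
  Avoids M X = ∃[ c ] ∃[ d ] ((c , d) ∈ M × c ∉ X × d ∉ X)

  without : Fin n → List (Fin n) → List (Fin n)
  without z = filter (λ x → ¬? (x ≟ z))

  without-shorter : ∀ {z X} → z ∈ X → length (without z X) < length X
  without-shorter {z} {X} z∈X = filter-notAll _ X (Any.map (λ z≡x x≢z → x≢z (sym z≡x)) z∈X)

  -- If an endpoint z of the head edge (c , d) lies in X, an edge of the
  -- rest avoiding X minus z avoids X itself, since z is not covered by it.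
  avoids-cons : ∀ {c d M X z} → All (c ≢_) (d ∷ flatten M) → All (d ≢_) (flatten M) →
    z ∈ₚ (c , d) → Avoids M (without z X) → Avoids ((c , d) ∷ M) X
  avoids-cons {M = M} {X} {z} c∉ d∉ z∈cd (c' , d' , cd∈M , c'∉ , d'∉) =
    c' , d' , there cd∈M ,
    keep (endpoint-covered cd∈M (inj₁ refl)) c'∉ , keep (endpoint-covered cd∈M (inj₂ refl)) d'∉
    where
    keep : ∀ {x} → x ∈ flatten M → x ∉ without z X → x ∉ X
    keep x∈M x∉ x∈X = x∉ (∈-filter⁺ (λ x → ¬? (x ≟ z)) x∈X (λ { refl → head-apart c∉ d∉ z∈cd x∈M }))

  matching-avoids : ∀ (M : List (Fin n × Fin n)) → Unique (flatten M) →
    (X : List (Fin n)) → length X < length M → Avoids M X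
  matching-avoids ((c , d) ∷ M) (c∉ ∷ d∉ ∷ u) X |X|≤|M| with c ∈? X | d ∈? X
  ... | no c∉X | no d∉X = c , d , here refl , c∉X , d∉X
  ... | yes c∈X | _ = avoids-cons c∉ d∉ (inj₁ refl)
    (matching-avoids M u _ (<-≤-trans (without-shorter c∈X) (s≤s⁻¹ |X|≤|M|)))
  ... | no _ | yes d∈X = avoids-cons c∉ d∉ (inj₂ refl)
    (matching-avoids M u _ (<-≤-trans (without-shorter d∈X) (s≤s⁻¹ |X|≤|M|)))

open Matchings

pair-cover : ∀ {A : Set} {p q u₁ u₂ : A} → u₁ ≡ p ⊎ u₁ ≡ q → u₂ ≡ p ⊎ u₂ ≡ q → u₁ ≢ u₂ →
  (p ≡ u₁ ⊎ p ≡ u₂) × (q ≡ u₁ ⊎ q ≡ u₂)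
pair-cover (inj₁ refl) (inj₁ refl) u₁≢u₂ = ⊥-elim (u₁≢u₂ refl)
pair-cover (inj₁ refl) (inj₂ refl) _ = inj₁ refl , inj₂ refl
pair-cover (inj₂ refl) (inj₁ refl) _ = inj₂ refl , inj₁ refl
pair-cover (inj₂ refl) (inj₂ refl) u₁≢u₂ = ⊥-elim (u₁≢u₂ refl)

pair-∈ : ∀ {A : Set} {t u₁ u₂ : A} → t ≡ u₁ ⊎ t ≡ u₂ → t ∈ u₁ ∷ u₂ ∷ []
pair-∈ (inj₁ t≡u₁) = here t≡u₁
pair-∈ (inj₂ t≡u₂) = there (here t≡u₂)

module Triples {n : ℕ} (H : Hypergraph3 n) where

  E-swap₁₂ : ∀ {a b c} → E H a b c ≡ true → E H b a c ≡ true
  E-swap₁₂ {a} {b} {c} = trans (sym (sym₁₂ H a b c))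

  E-swap₂₃ : ∀ {a b c} → E H a b c ≡ true → E H a c b ≡ true
  E-swap₂₃ {a} {b} {c} = trans (sym (sym₂₃ H a b c))

  E-rotate : ∀ {a b c} → E H a b c ≡ true → E H b c a ≡ true
  E-rotate = E-swap₂₃ ∘ E-swap₁₂

  E-distinct : ∀ {a b c} → E H a b c ≡ true → a ≢ b × a ≢ c × b ≢ c
  E-distinct {a} {b} {c} abc with distinct H a b c abc
  ... | (a≢b ∷ a≢c ∷ []) ∷ (b≢c ∷ []) ∷ [] ∷ [] = a≢b , a≢c , b≢c

  -- In an L-free H, three edges abc, cde, efg cannot form a loose path;
  -- distinctness inside each edge is automatic, so only the twelve cross
  -- conditions are required.
  noLoosePath : LFree H → ∀ {a b c d e f g} →
    E H a b c ≡ true → E H c d e ≡ true → E H e f g ≡ true →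
    a ≢ d → a ≢ e → a ≢ f → a ≢ g → b ≢ d → b ≢ e → b ≢ f → b ≢ g →
    c ≢ f → c ≢ g → d ≢ f → d ≢ g → ⊥
  noLoosePath lf {a} {b} {c} {d} {e} {f} {g} abc cde efg
    a≢d a≢e a≢f a≢g b≢d b≢e b≢f b≢g c≢f c≢g d≢f d≢g
    with E-distinct abc | E-distinct cde | E-distinct efg
  ... | a≢b , a≢c , b≢c | c≢d , c≢e , d≢e | e≢f , e≢g , f≢g =
    lf a b c d e f g
      ( (a≢b ∷ a≢c ∷ a≢d ∷ a≢e ∷ a≢f ∷ a≢g ∷ [])
      ∷ (b≢c ∷ b≢d ∷ b≢e ∷ b≢f ∷ b≢g ∷ [])
      ∷ (c≢d ∷ c≢e ∷ c≢f ∷ c≢g ∷ [])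
      ∷ (d≢e ∷ d≢f ∷ d≢g ∷ [])
      ∷ (e≢f ∷ e≢g ∷ [])
      ∷ (f≢g ∷ [])
      ∷ [] ∷ [])
      abc cde efg

module Trace {n : ℕ} (H : Hypergraph3 n) (S : VSet n) (y : Fin n) where
  open Triples H
  open import Data.List.Membership.DecPropositional (_≟_ {n}) using (_∈?_)

  trAdj : Fin n → Fin n → Bool
  trAdj v t = S y ∧ S v ∧ S t ∧ E H y v t

  link : Fin n → Fin n → Fin n → Bool
  link v u w = S v ∧ S u ∧ S w ∧ E H v u w

  degIn-pairCount : ∀ v → degIn H S v ≡ pairCount (link v)
  degIn-pairCount v = sum-allFin (λ u → countB (λ w → (toℕ u <ᵇ toℕ w) ∧ link v u w))

  traceEdge⁻ : ∀ {a b} → TrEdge H S y a b → S y ≡ true × S a ≡ true × S b ≡ true × E H y a b ≡ true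
  traceEdge⁻ {a} {b} = ∧₄-true⁻ (S y) (S a) (S b) (E H y a b)

  traceEdge-E : ∀ {a b} → TrEdge H S y a b → E H y a b ≡ true
  traceEdge-E = proj₂ ∘ proj₂ ∘ proj₂ ∘ traceEdge⁻

  traceEdge-sym : ∀ {a b} → TrEdge H S y a b → TrEdge H S y b a
  traceEdge-sym ab with traceEdge⁻ ab
  ... | Sy , Sa , Sb , yab = ∧₄-true⁺ Sy Sb Sa (E-swap₂₃ yab)

  traceEdge-distinct : ∀ {a b} → TrEdge H S y a b → y ≢ a × y ≢ b × a ≢ b
  traceEdge-distinct = E-distinct ∘ traceEdge-E

  -- If every edge at v passes through y, every edge at v is y plus a trace
  -- neighbour of v, so deg(v) ≤ deg_{Tr(y)}(v).
  degree≤traceDegree : ∀ {v} → (∀ {p q} → E H v p q ≡ true → p ≢ y → q ≢ y → ⊥) →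
    degIn H S v ≤ countB (trAdj v)
  degree≤traceDegree {v} throughY = begin
    degIn H S v           ≡⟨ degIn-pairCount v ⟩
    pairCount (link v)    ≤⟨ pairCount-star y (trAdj v) (λ p q vpq → throughY (linkEdge vpq))
                               partnerRight partnerLeft ⟩
    countB (trAdj v)      ∎
    where
    open ≤-Reasoning
    linkEdge : ∀ {p q} → link v p q ≡ true → E H v p q ≡ true
    linkEdge {p} {q} = proj₂ ∘ proj₂ ∘ proj₂ ∘ ∧₄-true⁻ (S v) (S p) (S q) (E H v p q)
    partnerRight : ∀ w → link v y w ≡ true → trAdj v w ≡ true
    partnerRight w vyw with ∧₄-true⁻ (S v) (S y) (S w) (E H v y w) vyw
    ... | Sv , Sy , Sw , E-vyw = ∧₄-true⁺ Sy Sv Sw (E-swap₁₂ E-vyw)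
    partnerLeft : ∀ u → link v u y ≡ true → trAdj v u ≡ true
    partnerLeft u vuy with ∧₄-true⁻ (S v) (S u) (S y) (E H v u y) vuy
    ... | Sv , Su , Sy , E-vuy = ∧₄-true⁺ Sy Sv Su (E-rotate (E-rotate E-vuy))

  otherNeighbour? : ∀ v (ws : List (Fin n)) →
    (∃[ t ] (t ∉ ws × TrEdge H S y v t)) ⊎ (∀ t → TrEdge H S y v t → t ∈ ws)
  otherNeighbour? v ws with any? (λ t → ¬? (t ∈? ws) ×-dec (trAdj v t ≟ᵇ true))
  ... | yes found = inj₁ found
  ... | no none = inj₂ (λ t v~t → decidable-stable (t ∈? ws) (λ t∉ws → none (t , t∉ws , v~t)))

  neighbours : Fin n → List (Fin n)
  neighbours v = filter (λ t → trAdj v t ≟ᵇ true) (allFin n)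

  componentAtLeast : ∀ {x v} k → TrConnected H S y x v → k ≤ countB (trAdj v) →
    ComponentAtLeast H S y x (suc k)
  componentAtLeast {x} {v} k x~v k≤deg =
    v ∷ take k nbrs ,
    cong suc (trans (length-take k nbrs) (m≤n⇒m⊓n≡m k≤|nbrs|)) ,
    All.take⁺ k (All.map (proj₂ ∘ proj₂ ∘ traceEdge-distinct) adjacent)
      ∷ Unique.take⁺ k (Unique.filter⁺ _ (Unique.allFin⁺ n)) ,
    x~v ∷ All.take⁺ k (All.map (λ v~t → x~v ◅◅ (v~t ◅ ε)) adjacent)
    where
    nbrs : List (Fin n)
    nbrs = neighbours v
    adjacent : All (TrEdge H S y v) nbrs
    adjacent = All.all-filter _ (allFin n)
    k≤|nbrs| : k ≤ length nbrs
    k≤|nbrs| = subst (k ≤_) (sym (length-filter-true (trAdj v) (allFin n))) k≤deg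

  componentIsEdge : ∀ {x w} → (∀ t → TrEdge H S y x t → t ∈ w ∷ []) →
    (∀ t → TrEdge H S y w t → t ∈ x ∷ []) → ComponentAtMost H S y x 2
  componentIsEdge {x} {w} onlyW onlyX = x ∷ w ∷ [] , ≤-refl , (λ z → walk (here refl))
    where
    walk : ∀ {a z} → a ∈ x ∷ w ∷ [] → TrConnected H S y a z → z ∈ x ∷ w ∷ []
    walk a∈ ε = a∈
    walk (here refl) (x~b ◅ rest) = walk (there (onlyW _ x~b)) rest
    walk (there (here refl)) (w~b ◅ rest) with onlyX _ w~b
    ... | here b≡x = walk (here b≡x) rest

  module LargeMatching (lf : LFree H) {M : List (Fin n × Fin n)}
    (matching : IsTrMatching H S y M) (ν>3 : 3 < length M) where

    edges : All (λ { (u , w) → TrEdge H S y u w }) M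
    edges = proj₁ matching

    unique : Unique (flatten M)
    unique = proj₂ matching

    -- An edge {v,p,q} avoiding y cannot meet a matching edge P = {p,r} of
    -- Tr(y) in p alone: a matching edge {c,d} disjoint from {q,v,p} is
    -- disjoint from P, and qvp, pry, ycd is a loose path.
    pendant-free : ∀ {P v p q r} → P ∈ M → p ∈ₚ P → r ∈ₚ P → TrEdge H S y p r →
      E H v p q ≡ true → v ≢ y → q ≢ y → r ≢ v → r ≢ q → ⊥
    pendant-free {P} {v} {p} {q} {r} P∈M p∈P r∈P y~pr vpq v≢y q≢y r≢v r≢q
      with matching-avoids M unique (q ∷ v ∷ p ∷ []) ν>3
    ... | c , d , cd∈M , c∉ , d∉
      with All.¬Any⇒All¬ _ c∉ | All.¬Any⇒All¬ _ d∉
    ... | c≢q ∷ c≢v ∷ c≢p ∷ [] | d≢q ∷ d≢v ∷ d≢p ∷ [] =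
      noLoosePath lf (E-rotate (E-rotate vpq)) (E-rotate (traceEdge-E y~pr))
        (traceEdge-E (All.lookup edges cd∈M))
        (≢-sym r≢q) q≢y (≢-sym c≢q) (≢-sym d≢q)
        (≢-sym r≢v) v≢y (≢-sym c≢v) (≢-sym d≢v)
        (≢-sym c≢p) (≢-sym d≢p) (r∉cd ∘ inj₁) (r∉cd ∘ inj₂)
      where
      r∉cd : r ∈ₚ (c , d) → ⊥
      r∉cd r∈cd with subst (p ∈ₚ_) (matching-shared unique P∈M cd∈M r∈P r∈cd) p∈P
      ... | inj₁ p≡c = c≢p (sym p≡c)
      ... | inj₂ p≡d = d≢p (sym p≡d)

    -- Otherwise take a matching edge {c,d}
    -- disjoint from {u,v,q}: if it meets p, pendant-free applies, and if
    -- not, cdy, yuv, vpq is a loose path.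
    link-contains : ∀ {v u p q} → TrEdge H S y v u → E H v p q ≡ true →
      p ≢ y → q ≢ y → u ≡ p ⊎ u ≡ q
    link-contains {v} {u} {p} {q} y~vu vpq p≢y q≢y with u ≟ p | u ≟ q
    ... | yes u≡p | _ = inj₁ u≡p
    ... | no _ | yes u≡q = inj₂ u≡q
    ... | no u≢p | no u≢q with matching-avoids M unique (u ∷ v ∷ q ∷ []) ν>3
    ...   | c , d , cd∈M , c∉ , d∉
      with All.¬Any⇒All¬ _ c∉ | All.¬Any⇒All¬ _ d∉ | traceEdge-distinct y~vu | c ≟ p | d ≟ p
    ... | c≢u ∷ c≢v ∷ c≢q ∷ [] | d≢u ∷ d≢v ∷ d≢q ∷ [] | y≢v , _ | yes refl | _ =
      ⊥-elim (pendant-free cd∈M (inj₁ refl) (inj₂ refl) (All.lookup edges cd∈M) vpq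
                (≢-sym y≢v) q≢y d≢v d≢q)
    ... | c≢u ∷ c≢v ∷ c≢q ∷ [] | d≢u ∷ d≢v ∷ d≢q ∷ [] | y≢v , _ | no _ | yes refl =
      ⊥-elim (pendant-free cd∈M (inj₂ refl) (inj₁ refl) (traceEdge-sym (All.lookup edges cd∈M)) vpq
                (≢-sym y≢v) q≢y c≢v c≢q)
    ... | c≢u ∷ c≢v ∷ c≢q ∷ [] | d≢u ∷ d≢v ∷ d≢q ∷ [] | _ | no c≢p | no d≢p =
      ⊥-elim (noLoosePath lf
        (E-rotate (traceEdge-E (All.lookup edges cd∈M)))
        (E-swap₂₃ (traceEdge-E y~vu)) vpq
        c≢u c≢v c≢p c≢q d≢u d≢v d≢p d≢q (≢-sym p≢y) (≢-sym q≢y) u≢p u≢q)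

    threeNeighbours⇒throughY : ∀ {v u₁ u₂ u₃} → TrEdge H S y v u₁ → TrEdge H S y v u₂ →
      TrEdge H S y v u₃ → u₁ ≢ u₂ → u₃ ∉ u₁ ∷ u₂ ∷ [] →
      ∀ {p q} → E H v p q ≡ true → p ≢ y → q ≢ y → ⊥
    threeNeighbours⇒throughY v~u₁ v~u₂ v~u₃ u₁≢u₂ u₃∉ vpq p≢y q≢y
      with pair-cover (link-contains v~u₁ vpq p≢y q≢y) (link-contains v~u₂ vpq p≢y q≢y) u₁≢u₂
         | link-contains v~u₃ vpq p≢y q≢y
    ... | p∈ , _ | inj₁ refl = u₃∉ (pair-∈ p∈)
    ... | _ , q∈ | inj₂ refl = u₃∉ (pair-∈ q∈)

    -- If v has exactly the trace neighbours u₁ ≠ u₂, every edge at v lies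
    -- in {v, y, u₁, u₂}, so deg(v) ≤ 3².
    twoNeighbours⇒degree≤9 : ∀ {v u₁ u₂} → TrEdge H S y v u₁ → TrEdge H S y v u₂ → u₁ ≢ u₂ →
      (∀ t → TrEdge H S y v t → t ∈ u₁ ∷ u₂ ∷ []) → degIn H S v ≤ 9
    twoNeighbours⇒degree≤9 {v} {u₁} {u₂} v~u₁ v~u₂ u₁≢u₂ onlyU = begin
      degIn H S v                              ≡⟨ degIn-pairCount v ⟩
      pairCount (link v)                       ≤⟨ pairCount-box (memberB Z) inZ ⟩
      countB (memberB Z) * countB (memberB Z)  ≤⟨ *-mono-≤ (countB-memberB Z) (countB-memberB Z) ⟩
      9                                        ∎
      where
      open ≤-Reasoning
      Z : List (Fin n)
      Z = y ∷ u₁ ∷ u₂ ∷ []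
      inside : ∀ p q → E H v p q ≡ true → S y ≡ true → S v ≡ true → S p ≡ true → S q ≡ true →
        p ∈ Z × q ∈ Z
      inside p q vpq Sy Sv Sp Sq with p ≟ y | q ≟ y
      ... | yes refl | _ = here refl , there (onlyU q (∧₄-true⁺ Sy Sv Sq (E-swap₁₂ vpq)))
      ... | no _ | yes refl =
        there (onlyU p (∧₄-true⁺ Sy Sv Sp (E-rotate (E-rotate vpq)))) , here refl
      ... | no p≢y | no q≢y with pair-cover (link-contains v~u₁ vpq p≢y q≢y)
                                             (link-contains v~u₂ vpq p≢y q≢y) u₁≢u₂
      ...   | p∈ , q∈ = there (pair-∈ p∈) , there (pair-∈ q∈)
      inZ : ∀ p q → link v p q ≡ true → memberB Z p ≡ true × memberB Z q ≡ true
      inZ p q vpq with ∧₄-true⁻ (S v) (S p) (S q) (E H v p q) vpq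
      ... | Sv , Sp , Sq , E-vpq with inside p q E-vpq (proj₁ (traceEdge⁻ v~u₁)) Sv Sp Sq
      ...   | p∈Z , q∈Z = memberB-∈ p∈Z , memberB-∈ q∈Z

    highDegree⇒degree≤traceDegree : ∀ {v u₁ u₂} → 10 ≤ degIn H S v →
      TrEdge H S y v u₁ → TrEdge H S y v u₂ → u₁ ≢ u₂ → degIn H S v ≤ countB (trAdj v)
    highDegree⇒degree≤traceDegree {v} {u₁} {u₂} 10≤deg v~u₁ v~u₂ u₁≢u₂
      with otherNeighbour? v (u₁ ∷ u₂ ∷ [])
    ... | inj₁ (u₃ , u₃∉ , v~u₃) =
      degree≤traceDegree (threeNeighbours⇒throughY v~u₁ v~u₂ v~u₃ u₁≢u₂ u₃∉)
    ... | inj₂ onlyU =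
      ⊥-elim (<⇒≱ (s≤s (twoNeighbours⇒degree≤9 v~u₁ v~u₂ u₁≢u₂ onlyU)) 10≤deg)

    largeComponent : ∀ {k x v u₁ u₂} → 10 ≤ k → (∀ v → S v ≡ true → k ≤ degIn H S v) →
      TrConnected H S y x v → TrEdge H S y v u₁ → TrEdge H S y v u₂ → u₁ ≢ u₂ →
      ComponentAtLeast H S y x (suc k)
    largeComponent {k} {v = v} 10≤k minDegree x~v v~u₁ v~u₂ u₁≢u₂ =
      componentAtLeast k x~v
        (≤-trans k≤deg (highDegree⇒degree≤traceDegree (≤-trans 10≤k k≤deg) v~u₁ v~u₂ u₁≢u₂))
      where
      k≤deg : k ≤ degIn H S v
      k≤deg = minDegree v (proj₁ (proj₂ (traceEdge⁻ v~u₁)))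

mainTheorem9 : (n : ℕ) (H : Hypergraph3 n) → LFree H →
    (S : VSet n) → IsCore 22 H S →
    (y : Fin n) → S y ≡ true → MatchingNumberAtLeast H S y 4 →
    (x : Fin n) → TrVertex H S y x →
    ComponentAtMost H S y x 2 ⊎ ComponentAtLeast H S y x 23
mainTheorem9 n H lf S (_ , minDegree) y _ (M , matching , size) x (w₀ , x~w₀) = dichotomy
  where
  open Trace H S y
  open LargeMatching lf matching (≤-reflexive (sym size))

  -- the core has minimum degree 22 ≥ 10
  large : ∀ {v u₁ u₂} → TrConnected H S y x v → TrEdge H S y v u₁ → TrEdge H S y v u₂ →
    u₁ ≢ u₂ → ComponentAtLeast H S y x 23
  large = largeComponent (m≤m+n 10 12) minDegree

  apart : ∀ {w t} → t ∉ w ∷ [] → w ≢ t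
  apart t∉ w≡t = t∉ (here (sym w≡t))

  dichotomy : ComponentAtMost H S y x 2 ⊎ ComponentAtLeast H S y x 23
  dichotomy with otherNeighbour? x (w₀ ∷ []) | otherNeighbour? w₀ (x ∷ [])
  ... | inj₁ (t , t∉ , x~t) | _ = inj₂ (large ε x~w₀ x~t (apart t∉))
  ... | inj₂ _ | inj₁ (t , t∉ , w₀~t) = inj₂ (large (x~w₀ ◅ ε) (traceEdge-sym x~w₀) w₀~t (apart t∉))
  ... | inj₂ onlyW₀ | inj₂ onlyX = inj₁ (componentIsEdge onlyW₀ onlyX)
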